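{- Let $k\ge 1$ be an integer. For every graph $G$ without isolated vertices, $\gamma_t(G)\le \gamma_{k{\rm rt}}(G)\le k\,\gamma_t(G)$. Moreover, the upper bound is tight: equality $\gamma_{k{\rm rt}}(G)=k\gamma_t(G)$ holds for $G=K_{a,b}$ with $a,b\ge 2k$.
   Context: All graphs are finite, simple and undirected; $N(v)$ denotes the open neighborhood of $v$, and $[k]=\{1,\dots,k\}$. $\gamma_t(G)$ is the total domination number (minimum size of a set $D$ such that every vertex of $G$ has a neighbor in $D$). A $k$-rainbow total dominating function ($k$RTDF) of $G$ is a function $f:V(G)\to 2^{[k]}$ such that (i) every vertex $v$ with $f(v)=\emptyset$ satisfies $\bigcup_{u\in N(v)}f(u)=[k]$, and (ii) for every vertex $v$ with $f(v)=\{i\}$ there is $u\in N(v)$ with $i\in f(u)$. Its weight is $\|f\|=\sum_{v}|f(v)|$ and $\gamma_{k{\rm rt}}(G)$ is the minimum weight of a $k$RTDF. $K_{a,b}$ is the complete bipartite graph with parts of sizes $a$ and $b$. -}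

module Defs where

open import Data.Nat using (ℕ; _+_; _*_; _≤_; _<ᵇ_)
open import Data.Bool using (Bool; true; false; _xor_)
open import Data.Fin using (Fin; toℕ)
open import Data.Fin.Subset using (Subset; _∈_; ∣_∣; ⁅_⁆) renaming (⊥ to ∅)
open import Data.Vec using (tabulate; sum)
open import Data.Product using (Σ; ∃; _×_)
open import Relation.Binary.PropositionalEquality using (_≡_; _≢_)
open import Relation.Nullary using (¬_)

record Graph : Set where
  field
    n     : ℕ
    adj   : Fin n → Fin n → Bool
    sym   : ∀ u v → adj u v ≡ adj v u
    irrefl : ∀ v → adj v v ≡ false
open Graph public

Adj : (G : Graph) → Fin (n G) → Fin (n G) → Set
Adj G u v = adj G u v ≡ true

NoIsolated : Graph → Set
NoIsolated G = ∀ v → ∃ λ u → Adj G v u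

IsTDS : (G : Graph) → Subset (n G) → Set
IsTDS G D = ∀ v → ∃ λ u → Adj G v u × u ∈ D

IsTotalDomNumber : Graph → ℕ → Set
IsTotalDomNumber G m =
  (Σ (Subset (n G)) λ D → IsTDS G D × ∣ D ∣ ≡ m) ×
  (∀ D → IsTDS G D → m ≤ ∣ D ∣)

-- k-rainbow total dominating function; [k] is modelled as Fin k
IsKRTDF : (k : ℕ) (G : Graph) → (Fin (n G) → Subset k) → Set
IsKRTDF k G f =
  (∀ v → f v ≡ ∅ → ∀ (i : Fin k) → ∃ λ u → Adj G v u × i ∈ f u) ×
  (∀ v (i : Fin k) → f v ≡ ⁅ i ⁆ → ∃ λ u → Adj G v u × i ∈ f u)

weight : (k : ℕ) (G : Graph) → (Fin (n G) → Subset k) → ℕ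
weight k G f = sum (tabulate (λ v → ∣ f v ∣))

IsKRTDNumber : ℕ → Graph → ℕ → Set
IsKRTDNumber k G m =
  (Σ (Fin (n G) → Subset k) λ f → IsKRTDF k G f × weight k G f ≡ m) ×
  (∀ f → IsKRTDF k G f → m ≤ weight k G f)

side : (a b : ℕ) → Fin (a + b) → Bool
side a b v = toℕ v <ᵇ a

K : (a b : ℕ) → Graph
K a b = record
  { n = a + b
  ; adj = λ u v → side a b u xor side a b v
  ; sym = λ u v → xorcomm (side a b u) (side a b v)
  ; irrefl = λ v → xorself (side a b v)
  }
  where
  xorcomm : ∀ x y → (x xor y) ≡ (y xor x)
  xorcomm true true = _≡_.refl
  xorcomm true false = _≡_.refl
  xorcomm false true = _≡_.refl
  xorcomm false false = _≡_.refl
  xorself : ∀ x → (x xor x) ≡ false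
  xorself true = _≡_.refl
  xorself false = _≡_.refl

module Submission where

-- Upper bound: a total dominating set D gives the kRTDF that puts all k
-- colours on D and nothing elsewhere; its weight is k·|D|.
-- Lower bound: from a kRTDF f charge every vertex w to the set
--   ∅ if f(w) = ∅,  {w} if |f(w)| = 1,  {w, x_w} if |f(w)| ≥ 2,
-- where x_w is a fixed neighbour of w; these have size ≤ |f(w)| and their
-- union is a total dominating set of size ≤ weight(f).
-- Sharpness: γ_t(K_{a,b}) ≤ 2, while any kRTDF of K_{a,b} has weight ≥ 2k:
-- if some vertex of one side is labelled ∅, the other side (its whole
-- neighbourhood) carries all k colours; otherwise that side alone has
-- weight ≥ its size ≥ 2k.  Hence k·γ_t ≤ 2k ≤ γ_krt ≤ k·γ_t.

open import Defs hiding (sym)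
open import Data.Nat using (ℕ; zero; suc; _+_; _*_; _≤_; z≤n; s≤s)
open import Data.Nat.Properties
  using (≤-reflexive; ≤-trans; ≤-antisym; ≤-<-trans; +-mono-≤; +-monoʳ-≤;
         *-monoʳ-≤; *-comm; *-identityˡ; +-assoc; +-suc; *-suc; *-zeroʳ; m≤m+n; m≤n+m; n≤1+n; module ≤-Reasoning)
open import Data.Bool using (true; false)
open import Data.Fin using (Fin; zero; suc; _↑ˡ_; _↑ʳ_)
open import Data.Fin.Subset using (Subset; _∈_; ∣_∣; ⁅_⁆; _∪_) renaming (⊥ to ∅; ⊤ to full)
open import Data.Fin.Subset.Properties
  using (∣⁅x⁆∣≡1; ∣⊥∣≡0; ∣⊤∣≡n; x∈⁅x⁆; ∈⊤; p⊆q⇒∣p∣≤∣q∣; p⊆p∪q; q⊆p∪q; x∈p⇒∣p-x∣<∣p∣)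
open import Data.Vec using ([]; _∷_; tabulate; sum; lookup)
open import Data.Vec.Properties using ([]=⇒lookup)
open import Data.Product using (Σ; ∃; _×_; _,_; proj₁; proj₂)
open import Data.Sum using (_⊎_; inj₁; inj₂)
open import Relation.Binary.PropositionalEquality using (_≡_; refl; sym; trans; cong; cong₂; subst)

∑ : ∀ {m} → (Fin m → ℕ) → ℕ
∑ g = sum (tabulate g)

∑-mono-≤ : ∀ {m} (g h : Fin m → ℕ) → (∀ j → g j ≤ h j) → ∑ g ≤ ∑ h
∑-mono-≤ {zero}  g h g≤h = z≤n
∑-mono-≤ {suc m} g h g≤h =
  +-mono-≤ (g≤h zero) (∑-mono-≤ (λ j → g (suc j)) (λ j → h (suc j)) (λ j → g≤h (suc j)))

∑-split : ∀ a {b} (g : Fin (a + b) → ℕ) →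
  ∑ g ≡ ∑ (λ i → g (i ↑ˡ b)) + ∑ (λ j → g (a ↑ʳ j))
∑-split zero    g = refl
∑-split (suc a) g =
  trans (cong (g zero +_) (∑-split a (λ j → g (suc j)))) (sym (+-assoc (g zero) _ _))

∣p∪q∣≤∣p∣+∣q∣ : ∀ {n} (p q : Subset n) → ∣ p ∪ q ∣ ≤ ∣ p ∣ + ∣ q ∣
∣p∪q∣≤∣p∣+∣q∣ []          []          = z≤n
∣p∪q∣≤∣p∣+∣q∣ (true ∷ p)  (true ∷ q)  =
  s≤s (≤-trans (∣p∪q∣≤∣p∣+∣q∣ p q) (≤-trans (n≤1+n _) (≤-reflexive (sym (+-suc ∣ p ∣ ∣ q ∣)))))
∣p∪q∣≤∣p∣+∣q∣ (true ∷ p)  (false ∷ q) = s≤s (∣p∪q∣≤∣p∣+∣q∣ p q)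
∣p∪q∣≤∣p∣+∣q∣ (false ∷ p) (true ∷ q)  =
  ≤-trans (s≤s (∣p∪q∣≤∣p∣+∣q∣ p q)) (≤-reflexive (sym (+-suc ∣ p ∣ ∣ q ∣)))
∣p∪q∣≤∣p∣+∣q∣ (false ∷ p) (false ∷ q) = ∣p∪q∣≤∣p∣+∣q∣ p q

⋃ᶠ : ∀ {m n} → (Fin m → Subset n) → Subset n
⋃ᶠ {zero}  g = ∅
⋃ᶠ {suc m} g = g zero ∪ ⋃ᶠ (λ j → g (suc j))

∣⋃ᶠ∣≤∑ : ∀ {m n} (g : Fin m → Subset n) → ∣ ⋃ᶠ g ∣ ≤ ∑ (λ j → ∣ g j ∣)
∣⋃ᶠ∣≤∑ {zero} {n} g = ≤-reflexive (∣⊥∣≡0 n)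
∣⋃ᶠ∣≤∑ {suc m}    g =
  ≤-trans (∣p∪q∣≤∣p∣+∣q∣ (g zero) _) (+-monoʳ-≤ ∣ g zero ∣ (∣⋃ᶠ∣≤∑ (λ j → g (suc j))))

∈⋃ᶠ : ∀ {m n} (g : Fin m → Subset n) (j : Fin m) {x} → x ∈ g j → x ∈ ⋃ᶠ g
∈⋃ᶠ {suc m} g zero    x∈g = p⊆p∪q _ x∈g
∈⋃ᶠ {suc m} g (suc j) x∈g = q⊆p∪q (g zero) _ (∈⋃ᶠ (λ j → g (suc j)) j x∈g)

cover-bound : ∀ {m k} (g : Fin m → Subset k) → (∀ c → Σ (Fin m) λ j → c ∈ g j) →
  k ≤ ∑ (λ j → ∣ g j ∣)
cover-bound {k = k} g covers = begin
  k              ≡⟨ sym (∣⊤∣≡n k) ⟩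
  ∣ full {k} ∣   ≤⟨ p⊆q⇒∣p∣≤∣q∣ {p = full} (λ {c} _ → let (j , c∈g) = covers c in ∈⋃ᶠ g j c∈g) ⟩
  ∣ ⋃ᶠ g ∣       ≤⟨ ∣⋃ᶠ∣≤∑ g ⟩
  ∑ (λ j → ∣ g j ∣) ∎
  where open ≤-Reasoning

-- A colour set is empty, a singleton, or has at least two colours;
-- these are exactly the cases distinguished by the rainbow conditions.
data Shape {k} (p : Subset k) : Set where
  empty     : p ≡ ∅ → Shape p
  singleton : (i : Fin k) → p ≡ ⁅ i ⁆ → Shape p
  large     : 2 ≤ ∣ p ∣ → Shape p

shape : ∀ {k} (p : Subset k) → Shape p
shape [] = empty refl
shape (false ∷ p) with shape p
... | empty p≡∅       = empty (cong (false ∷_) p≡∅)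
... | singleton i p≡i = singleton (suc i) (cong (false ∷_) p≡i)
... | large 2≤p       = large 2≤p
shape (true ∷ p) with shape p
... | empty p≡∅       = singleton zero (cong (true ∷_) p≡∅)
... | singleton i p≡i = large (s≤s (≤-reflexive (sym (trans (cong ∣_∣ p≡i) (∣⁅x⁆∣≡1 i)))))
... | large 2≤p       = large (≤-trans 2≤p (n≤1+n _))

∈⇒1≤∣∣ : ∀ {k} {p : Subset k} {i} → i ∈ p → 1 ≤ ∣ p ∣
∈⇒1≤∣∣ i∈p = ≤-<-trans z≤n (x∈p⇒∣p-x∣<∣p∣ i∈p)

someEmpty-or-large : ∀ {m k} (g : Fin m → Subset k) →
  (Σ (Fin m) λ j → g j ≡ ∅) ⊎ (m ≤ ∑ (λ j → ∣ g j ∣))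
someEmpty-or-large {zero} g = inj₂ z≤n
someEmpty-or-large {suc m} g with shape (g zero) | someEmpty-or-large (λ j → g (suc j))
... | empty e         | _                = inj₁ (zero , e)
... | _               | inj₁ (j , e)     = inj₁ (suc j , e)
... | singleton i e   | inj₂ m≤rest      = inj₂ (+-mono-≤ (≤-reflexive (sym (trans (cong ∣_∣ e) (∣⁅x⁆∣≡1 i)))) m≤rest)
... | large 2≤g       | inj₂ m≤rest      = inj₂ (+-mono-≤ (≤-trans (s≤s z≤n) 2≤g) m≤rest)

charged : ∀ {n} → ℕ → Fin n → Fin n → Subset n
charged zero          w x = ∅
charged (suc zero)    w x = ⁅ w ⁆
charged (suc (suc _)) w x = ⁅ w ⁆ ∪ ⁅ x ⁆

∣charged∣≤ : ∀ {n} m (w x : Fin n) → ∣ charged m w x ∣ ≤ m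
∣charged∣≤ {n} zero        w x = ≤-reflexive (∣⊥∣≡0 n)
∣charged∣≤ (suc zero)      w x = ≤-reflexive (∣⁅x⁆∣≡1 w)
∣charged∣≤ (suc (suc m)) w x =
  ≤-trans (∣p∪q∣≤∣p∣+∣q∣ ⁅ w ⁆ ⁅ x ⁆)
          (≤-trans (≤-reflexive (cong₂ _+_ (∣⁅x⁆∣≡1 w) (∣⁅x⁆∣≡1 x))) (s≤s (s≤s z≤n)))

self∈charged : ∀ {n} m (w x : Fin n) → 1 ≤ m → w ∈ charged m w x
self∈charged (suc zero)    w x _ = x∈⁅x⁆ w
self∈charged (suc (suc m)) w x _ = p⊆p∪q ⁅ x ⁆ (x∈⁅x⁆ w)

nbr∈charged : ∀ {n} m (w x : Fin n) → 2 ≤ m → x ∈ charged m w x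
nbr∈charged (suc zero)    w x (s≤s ())
nbr∈charged (suc (suc m)) w x _ = q⊆p∪q ⁅ w ⁆ ⁅ x ⁆ (x∈⁅x⁆ x)

-- The union of all charges is a total dominating set of size ≤ weight(f):
-- a vertex labelled ∅ or {i} has a coloured neighbour (which lies in its
-- own charge), and a vertex with ≥ 2 colours charges its chosen neighbour.
kRTDF⇒TDS : ∀ {k} → 1 ≤ k → (G : Graph) → NoIsolated G →
  (f : Fin (n G) → Subset k) → IsKRTDF k G f →
  Σ (Subset (n G)) λ D → IsTDS G D × ∣ D ∣ ≤ weight k G f
kRTDF⇒TDS {suc k} _ G noIsolated f (emptyCond , singleCond) = D , dominating , size
  where
  nbr : Fin (n G) → Fin (n G)
  nbr v = proj₁ (noIsolated v)
  chargedTo : Fin (n G) → Subset (n G)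
  chargedTo w = charged ∣ f w ∣ w (nbr w)
  D : Subset (n G)
  D = ⋃ᶠ chargedTo
  size : ∣ D ∣ ≤ weight (suc k) G f
  size = ≤-trans (∣⋃ᶠ∣≤∑ chargedTo) (∑-mono-≤ _ _ (λ w → ∣charged∣≤ ∣ f w ∣ w (nbr w)))
  coloured∈D : ∀ u {i} → i ∈ f u → u ∈ D
  coloured∈D u i∈f = ∈⋃ᶠ chargedTo u (self∈charged ∣ f u ∣ u (nbr u) (∈⇒1≤∣∣ i∈f))
  dominating : IsTDS G D
  dominating v with shape (f v)
  ... | empty e       = let (u , vu , i∈f) = emptyCond v e zero in u , vu , coloured∈D u i∈f
  ... | singleton i e = let (u , vu , i∈f) = singleCond v i e in u , vu , coloured∈D u i∈f
  ... | large 2≤f     =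
    nbr v , proj₂ (noIsolated v) , ∈⋃ᶠ chargedTo v (nbr∈charged ∣ f v ∣ v (nbr v) 2≤f)

fullNeighbour⇒KRTDF : ∀ {k} (G : Graph) (f : Fin (n G) → Subset k) →
  (∀ v → ∃ λ u → Adj G v u × ∀ i → i ∈ f u) → IsKRTDF k G f
fullNeighbour⇒KRTDF G f full-nbr =
  (λ v _ i → let (u , vu , all) = full-nbr v in u , vu , all i) ,
  (λ v i _ → let (u , vu , all) = full-nbr v in u , vu , all i)

saturate : ∀ {k m} → Subset m → Fin m → Subset k
saturate D v with lookup D v
... | true  = full
... | false = ∅

saturate-full : ∀ {k m} (D : Subset m) {v} → v ∈ D → ∀ i → i ∈ saturate {k} D v
saturate-full D {v} v∈D i with lookup D v | []=⇒lookup v∈D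
... | true | _ = ∈⊤

saturate-weight : ∀ {k m} (D : Subset m) → ∑ (λ v → ∣ saturate {k} D v ∣) ≡ k * ∣ D ∣
saturate-weight {k} []          = sym (*-zeroʳ k)
saturate-weight {k} (true ∷ D)  =
  trans (cong₂ _+_ (∣⊤∣≡n k) (saturate-weight D)) (sym (*-suc k ∣ D ∣))
saturate-weight {k} (false ∷ D) = cong₂ _+_ (∣⊥∣≡0 k) (saturate-weight D)

TDS⇒kRTDF : ∀ k (G : Graph) (D : Subset (n G)) → IsTDS G D →
  Σ (Fin (n G) → Subset k) λ f → IsKRTDF k G f × weight k G f ≡ k * ∣ D ∣
TDS⇒kRTDF k G D dominating =
  saturate D ,
  fullNeighbour⇒KRTDF G (saturate D)
    (λ v → let (u , vu , u∈D) = dominating v in u , vu , saturate-full D u∈D) ,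
  saturate-weight D

γt≤γkrt : ∀ {k} → 1 ≤ k → (G : Graph) → NoIsolated G → ∀ {t r} →
  IsTotalDomNumber G t → IsKRTDNumber k G r → t ≤ r
γt≤γkrt 1≤k G noIsolated (_ , minimalT) ((f , rainbow , wf≡r) , _) =
  let (D , dominating , D≤wf) = kRTDF⇒TDS 1≤k G noIsolated f rainbow in
  ≤-trans (minimalT D dominating) (≤-trans D≤wf (≤-reflexive wf≡r))

γkrt≤kγt : ∀ k (G : Graph) → ∀ {t r} →
  IsTotalDomNumber G t → IsKRTDNumber k G r → r ≤ k * t
γkrt≤kγt k G ((D , dominating , D≡t) , _) (_ , minimalR) =
  let (f , rainbow , wf≡kD) = TDS⇒kRTDF k G D dominating in
  ≤-trans (minimalR f rainbow) (≤-reflexive (trans wf≡kD (cong (k *_) D≡t)))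

empty⇒cover : ∀ {k m} (G : Graph) (f : Fin (n G) → Subset k) → IsKRTDF k G f →
  (e : Fin m → Fin (n G)) (v : Fin (n G)) → f v ≡ ∅ →
  (∀ u → Adj G v u → Σ (Fin m) λ j → u ≡ e j) → k ≤ ∑ (λ j → ∣ f (e j) ∣)
empty⇒cover G f (emptyCond , _) e v fv≡∅ nbrs⊆e = cover-bound (λ j → f (e j)) colourAt
  where
  colourAt : ∀ c → Σ _ λ j → c ∈ f (e j)
  colourAt c with emptyCond v fv≡∅ c
  ... | u , vu , c∈fu with nbrs⊆e u vu
  ...   | j , refl = j , c∈fu

part-bound : ∀ {k m m'} (G : Graph) (f : Fin (n G) → Subset k) → IsKRTDF k G f →
  (e : Fin m → Fin (n G)) (e' : Fin m' → Fin (n G)) →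
  (∀ i u → Adj G (e i) u → Σ (Fin m') λ j → u ≡ e' j) →
  m ≤ ∑ (λ i → ∣ f (e i) ∣) ⊎ k ≤ ∑ (λ j → ∣ f (e' j) ∣)
part-bound G f rainbow e e' cross with someEmpty-or-large (λ i → f (e i))
... | inj₁ (i , e≡∅) = inj₂ (empty⇒cover G f rainbow e' (e i) e≡∅ (cross i))
... | inj₂ m≤w       = inj₁ m≤w

data Side a b : Fin (a + b) → Set where
  left  : (i : Fin a) → Side a b (i ↑ˡ b)
  right : (j : Fin b) → Side a b (a ↑ʳ j)

sideOf : ∀ a b (u : Fin (a + b)) → Side a b u
sideOf zero    b u       = right u
sideOf (suc a) b zero    = left zero
sideOf (suc a) b (suc u) with sideOf a b u
... | left i  = left (suc i)
... | right j = right j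

side-left : ∀ {a} b (i : Fin a) → side a b (i ↑ˡ b) ≡ true
side-left b zero = refl
side-left {suc a} b (suc i) = side-left {a} b i

side-right : ∀ a b (j : Fin b) → side a b (a ↑ʳ j) ≡ false
side-right zero    b j = refl
side-right (suc a) b j = side-right a b j

left-nbrs : ∀ a b (i : Fin a) u → Adj (K a b) (i ↑ˡ b) u → Σ (Fin b) λ j → u ≡ a ↑ʳ j
left-nbrs a b i u iu with sideOf a b u
... | right j = j , refl
... | left i' rewrite side-left b i | side-left b i' with iu
...   | ()

right-nbrs : ∀ a b (j : Fin b) u → Adj (K a b) (a ↑ʳ j) u → Σ (Fin a) λ i → u ≡ i ↑ˡ b
right-nbrs a b j u ju with sideOf a b u
... | left i = i , refl
... | right j' rewrite side-right a b j | side-right a b j' with ju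
...   | ()

left-right : ∀ a b (i : Fin a) (j : Fin b) → Adj (K a b) (i ↑ˡ b) (a ↑ʳ j)
left-right a b i j rewrite side-left b i | side-right a b j = refl

right-left : ∀ a b (i : Fin a) (j : Fin b) → Adj (K a b) (a ↑ʳ j) (i ↑ˡ b)
right-left a b i j rewrite side-left b i | side-right a b j = refl

γt-K≤2 : ∀ {a b} → 1 ≤ a → 1 ≤ b → ∀ {t} → IsTotalDomNumber (K a b) t → t ≤ 2
γt-K≤2 {suc a} {suc b} _ _ (_ , minimalT) =
  ≤-trans (minimalT D dominating)
          (≤-trans (∣p∪q∣≤∣p∣+∣q∣ ⁅ l ⁆ ⁅ r ⁆) (≤-reflexive (cong₂ _+_ (∣⁅x⁆∣≡1 l) (∣⁅x⁆∣≡1 r))))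
  where
  l r : Fin (suc a + suc b)
  l = zero ↑ˡ suc b
  r = suc a ↑ʳ zero
  D : Subset (suc a + suc b)
  D = ⁅ l ⁆ ∪ ⁅ r ⁆
  dominating : IsTDS (K (suc a) (suc b)) D
  dominating v with sideOf (suc a) (suc b) v
  ... | left i  = r , left-right (suc a) (suc b) i zero , q⊆p∪q ⁅ l ⁆ ⁅ r ⁆ (x∈⁅x⁆ r)
  ... | right j = l , right-left (suc a) (suc b) zero j , p⊆p∪q ⁅ r ⁆ (x∈⁅x⁆ l)

-- Every kRTDF of K_{a,b} with a, b ≥ 2k has weight ≥ 2k: by part-bound
-- each side either weighs at least its size (≥ 2k) or forces weight ≥ k
-- onto the other side.
weight-K≥2k : ∀ k a b → 2 * k ≤ a → 2 * k ≤ b → (f : Fin (a + b) → Subset k) →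
  IsKRTDF k (K a b) f → 2 * k ≤ weight k (K a b) f
weight-K≥2k k a b 2k≤a 2k≤b f rainbow =
  subst (2 * k ≤_) (sym (∑-split a (λ v → ∣ f v ∣))) (combine leftBound rightBound)
  where
  wL wR : ℕ
  wL = ∑ (λ i → ∣ f (i ↑ˡ b) ∣)
  wR = ∑ (λ j → ∣ f (a ↑ʳ j) ∣)
  leftBound : a ≤ wL ⊎ k ≤ wR
  leftBound = part-bound (K a b) f rainbow (_↑ˡ b) (a ↑ʳ_) (left-nbrs a b)
  rightBound : b ≤ wR ⊎ k ≤ wL
  rightBound = part-bound (K a b) f rainbow (a ↑ʳ_) (_↑ˡ b) (right-nbrs a b)
  combine : a ≤ wL ⊎ k ≤ wR → b ≤ wR ⊎ k ≤ wL → 2 * k ≤ wL + wR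
  combine (inj₁ a≤wL) _            = ≤-trans 2k≤a (≤-trans a≤wL (m≤m+n wL wR))
  combine _           (inj₁ b≤wR)  = ≤-trans 2k≤b (≤-trans b≤wR (m≤n+m wR wL))
  combine (inj₂ k≤wR) (inj₂ k≤wL)  = +-mono-≤ k≤wL (≤-trans (≤-reflexive (*-identityˡ k)) k≤wR)

corollary6 : (k : ℕ) → 1 ≤ k →
    ((G : Graph) → NoIsolated G → (t r : ℕ) →
    IsTotalDomNumber G t → IsKRTDNumber k G r → t ≤ r × r ≤ k * t)
    × ((a b : ℕ) → 2 * k ≤ a → 2 * k ≤ b → (t r : ℕ) →
    IsTotalDomNumber (K a b) t → IsKRTDNumber k (K a b) r → r ≡ k * t)
corollary6 k 1≤k = bounds , sharp
  where
  bounds : (G : Graph) → NoIsolated G → (t r : ℕ) →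
    IsTotalDomNumber G t → IsKRTDNumber k G r → t ≤ r × r ≤ k * t
  bounds G noIsolated t r T R = γt≤γkrt 1≤k G noIsolated T R , γkrt≤kγt k G T R
  1≤2k : 1 ≤ 2 * k
  1≤2k = ≤-trans 1≤k (m≤m+n k _)
  sharp : (a b : ℕ) → 2 * k ≤ a → 2 * k ≤ b → (t r : ℕ) →
    IsTotalDomNumber (K a b) t → IsKRTDNumber k (K a b) r → r ≡ k * t
  sharp a b 2k≤a 2k≤b t r T R@((f , rainbow , wf≡r) , _) =
    ≤-antisym (γkrt≤kγt k (K a b) T R) (begin
      k * t              ≤⟨ *-monoʳ-≤ k (γt-K≤2 (≤-trans 1≤2k 2k≤a) (≤-trans 1≤2k 2k≤b) T) ⟩
      k * 2              ≡⟨ *-comm k 2 ⟩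
      2 * k              ≤⟨ weight-K≥2k k a b 2k≤a 2k≤b f rainbow ⟩
      weight k (K a b) f ≡⟨ wf≡r ⟩
      r                  ∎)
    where open ≤-Reasoning
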